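{- For every $G\subseteq A$ and every formula $\varphi\in\mathcal{L}_{CoRGAL}$, the formula $\langle[G]\rangle\varphi\to\langle G\rangle[A\setminus G]\varphi$ is valid.
   Context: Fix a finite set $A$ of agents and a countable set $P$ of propositional variables. The language $\mathcal{L}_{CoRGAL}$ is given by $\varphi ::= p \mid \neg\varphi \mid (\varphi\wedge\varphi) \mid K_a\varphi \mid [\varphi]\varphi \mid [G,\varphi]\varphi \mid [\langle G\rangle]\varphi$ with $p\in P$, $a\in A$, $G\subseteq A$; $\langle\varphi\rangle\psi:=\neg[\varphi]\neg\psi$, $\langle G,\chi\rangle\varphi:=\neg[G,\chi]\neg\varphi$, $\langle[G]\rangle\varphi:=\neg[\langle G\rangle]\neg\varphi$, $[G]\varphi:=[G,\top]\varphi$, $\langle G\rangle\varphi:=\langle G,\top\rangle\varphi$. $\mathcal{L}_{EL}$ is the fragment built only from $p,\neg,\wedge,K_a$. For $G\subseteq A$, $\mathcal{L}_{EL}^G$ is the set of formulas $\bigwedge_{i\in G}K_i\varphi_i$ with each $\varphi_i\in\mathcal{L}_{EL}$; $\psi_G$ denotes an element of $\mathcal{L}_{EL}^G$, $\chi_{A\setminus G}$ one of $\mathcal{L}_{EL}^{A\setminus G}$. An epistemic model is $M=(W,\sim,V)$ with $W\neq\emptyset$, each $\sim_a$ an equivalence relation, $V:P\to\mathcal{P}(W)$. $M^\varphi$ is the restriction of $M$ to the states where $\varphi$ holds. Semantics: $p,\neg,\wedge$ as usual; $K_a\varphi$ true at $w$ iff $\varphi$ true at all $v\sim_a w$; $(M,w)\models[\varphi]\psi$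 iff $(M,w)\models\varphi$ implies $(M^\varphi,w)\models\psi$; $(M,w)\models[G,\chi]\varphi$ iff $(M,w)\models\chi$ and for all $\psi_G$, $(M,w)\models[\psi_G\wedge\chi]\varphi$; $(M,w)\models[\langle G\rangle]\varphi$ iff for all $\psi_G$ there is $\chi_{A\setminus G}$ with $(M,w)\models\psi_G\to\langle\psi_G\wedge\chi_{A\setminus G}\rangle\varphi$. Equivalently, $(M,w)\models\langle[G]\rangle\varphi$ iff there is $\psi_G$ such that for all $\chi_{A\setminus G}$, $(M,w)\models\psi_G\wedge[\psi_G\wedge\chi_{A\setminus G}]\varphi$. Valid means true at every pointed model. -}

module Defs where

open import Level using (0ℓ)
open import Data.Nat using (ℕ)
open import Data.Fin using (Fin)
open import Data.Fin.Subset using (Subset; _∈_; ∁)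
open import Data.Product using (Σ; ∃; _×_; _,_; proj₁; proj₂)
open import Relation.Nullary using (¬_)
open import Relation.Binary.Structures using (IsEquivalence)

-- Agents: A = Fin n.  Propositional variables: P = ℕ.
-- Coalitions G ⊆ A: Subset n; A \ G is ∁ G.

data ELForm (n : ℕ) : Set where
  var : ℕ → ELForm n
  ¬ₑ_  : ELForm n → ELForm n
  _∧ₑ_ : ELForm n → ELForm n → ELForm n
  Kₑ   : Fin n → ELForm n → ELForm n

data Form (n : ℕ) : Set where
  var   : ℕ → Form n
  ¬'_   : Form n → Form n
  _∧'_  : Form n → Form n → Form n
  K     : Fin n → Form n → Form n
  [_]_  : Form n → Form n → Form n
  [_∣_]_ : Subset n → Form n → Form n → Form n
  [⟨_⟩]_ : Subset n → Form n → Form n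

infixr 6 _∧'_
infix 7 ¬'_

-- Epistemic models (W nonempty is automatic for pointed models)

record Model (n : ℕ) : Set₁ where
  field
    W     : Set
    R     : Fin n → W → W → Set
    R-eq  : (a : Fin n) → IsEquivalence (R a)
    V     : ℕ → W → Set

open Model public

_↾_ : ∀ {n} (M : Model n) → (W M → Set) → Model n
W (M ↾ D) = Σ (W M) D
R (M ↾ D) a (v , _) (u , _) = R M a v u
R-eq (M ↾ D) a = record
  { refl  = IsEquivalence.refl (R-eq M a)
  ; sym   = IsEquivalence.sym (R-eq M a)
  ; trans = IsEquivalence.trans (R-eq M a) }
V (M ↾ D) p (v , _) = V M p v

satEL : ∀ {n} (M : Model n) → W M → ELForm n → Set
satEL M w (var p)   = V M p w
satEL M w (¬ₑ φ)    = ¬ satEL M w φ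
satEL M w (φ ∧ₑ ψ)  = satEL M w φ × satEL M w ψ
satEL M w (Kₑ a φ)  = ∀ v → R M a w v → satEL M v φ

-- An element ψ_G = ⋀_{i∈G} K_i ψ_i of L_EL^G is given by a family
-- ψ : Fin n → ELForm n (only the components i ∈ G matter).
-- Truth of ψ_G at w:
satG : ∀ {n} (M : Model n) → W M → Subset n → (Fin n → ELForm n) → Set
satG M w G ψ = ∀ i → i ∈ G → satEL M w (Kₑ i (ψ i))

sat : ∀ {n} (M : Model n) → W M → Form n → Set
sat M w (var p)    = V M p w
sat M w (¬' φ)     = ¬ sat M w φ
sat M w (φ ∧' ψ)   = sat M w φ × sat M w ψ
sat M w (K a φ)    = ∀ v → R M a w v → sat M v φ
sat M w ([ φ ] ψ)  =
  (h : sat M w φ) → sat (M ↾ (λ v → sat M v φ)) (w , h) ψ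
sat M w ([ G ∣ χ ] φ) =
  sat M w χ ×
  ((ψ : Fin _ → ELForm _) →
     -- (M,w) ⊨ [ψ_G ∧ χ]φ
     (h : satG M w G ψ × sat M w χ) →
     sat (M ↾ (λ v → satG M v G ψ × sat M v χ)) (w , h) φ)
sat M w ([⟨ G ⟩] φ) =
  (ψ : Fin _ → ELForm _) →
  ∃ λ (χ : Fin _ → ELForm _) →
    -- (M,w) ⊨ ψ_G → ⟨ψ_G ∧ χ_{A∖G}⟩φ, with ⟨α⟩φ := ¬[α]¬φ
    satG M w G ψ →
    ¬ ((h : satG M w G ψ × satG M w (∁ G) χ) →
         ¬ sat (M ↾ (λ v → satG M v G ψ × satG M v (∁ G) χ)) (w , h) φ)

⊤' : ∀ {n} → Form n
⊤' = ¬' (var 0 ∧' ¬' var 0)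

_⇒_ : ∀ {n} → Form n → Form n → Form n
φ ⇒ ψ = ¬' (φ ∧' ¬' ψ)

[_]ᶜ_ : ∀ {n} → Subset n → Form n → Form n
[ G ]ᶜ φ = [ G ∣ ⊤' ] φ

⟨_⟩ᶜ_ : ∀ {n} → Subset n → Form n → Form n
⟨ G ⟩ᶜ φ = ¬' ([ G ∣ ⊤' ] (¬' φ))

⟨[_]⟩_ : ∀ {n} → Subset n → Form n → Form n
⟨[ G ]⟩ φ = ¬' ([⟨ G ⟩] (¬' φ))

Valid : ∀ {n} → Form n → Set₁
Valid {n} φ = (M : Model n) (w : W M) → sat M w φ

module Submission where

-- Classically, ⟨[G]⟩φ → ⟨G⟩[A∖G]φ is the contrapositive of
-- [G]¬[A∖G]φ → [⟨G⟩]¬φ, which we prove directly.  Assume [G]¬[A∖G]φ at (M,w)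
-- and let G announce ψ_G, true at w.  In the updated model M^{ψ_G} the
-- coalition A∖G has an announcement χ after which φ fails.  Announcing χ in
-- M^{ψ_G} has the same effect as announcing ψ_G ∧ χ' in M, where χ' is χ
-- relativised to the characteristic formula of ψ_G; relativisation keeps the
-- shape ⋀_{i∈A∖G} K_i(…), so χ' is again an announcement of A∖G and it is
-- the counter-announcement required by [⟨G⟩]¬φ.

open import Defs
open import Level using (0ℓ)
open import Data.Nat using (ℕ; zero; suc)
open import Data.Fin using (Fin; zero; suc)
open import Data.Fin.Subset using (Subset; _∈_; ∁)
open import Data.Fin.Subset.Properties using (_∈?_)
open import Data.Product using (Σ; ∃; _×_; _,_; proj₁; proj₂)
open import Data.Product.Function.NonDependent.Propositional using (_×-⇔_)
open import Data.Empty using (⊥-elim)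
open import Function.Bundles using (_⇔_; mk⇔; Equivalence)
open import Function.Construct.Composition using (_⇔-∘_)
open import Function.Construct.Identity using (⇔-id)
open import Function.Related.TypeIsomorphisms using (→-cong-⇔; ¬-cong-⇔)
open import Relation.Nullary using (¬_; yes; no)
open import Relation.Binary.PropositionalEquality using (_≡_; refl)
open import Axiom.ExcludedMiddle using (ExcludedMiddle)
open import Axiom.DoubleNegationElimination
  using (DoubleNegationElimination; em⇒dne)

open Equivalence using (to; from)

private
  variable
    n : ℕ

∀-cong : {I : Set} {P Q : I → Set} →
         (∀ i → P i ⇔ Q i) → (∀ i → P i) ⇔ (∀ i → Q i)
∀-cong P⇔Q = mk⇔ (λ p i → to (P⇔Q i) (p i)) (λ q i → from (P⇔Q i) (q i))

∃-cong : {I : Set} {P Q : I → Set} →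
         (∀ i → P i ⇔ Q i) → ∃ P ⇔ ∃ Q
∃-cong P⇔Q = mk⇔ (λ (i , p) → i , to (P⇔Q i) p)
                 (λ (i , q) → i , from (P⇔Q i) q)

-- A dependent implication over equivalent premises, whose conclusions agree
-- whatever proofs of the premises are used.  This is the shape of the
-- announcement clauses of the semantics.
Π-cong : {A B : Set} {P : A → Set} {Q : B → Set} →
         A ⇔ B → (∀ a b → P a ⇔ Q b) → ((a : A) → P a) ⇔ ((b : B) → Q b)
Π-cong A⇔B P⇔Q = mk⇔ (λ p b → to (P⇔Q (from A⇔B b) b) (p (from A⇔B b)))
                     (λ q a → from (P⇔Q a (to A⇔B a)) (q (to A⇔B a)))

¬∀⇒∃¬ : DoubleNegationElimination 0ℓ → {I : Set} {P : I → Set} →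
        ¬ (∀ i → P i) → ∃ λ i → ¬ P i
¬∀⇒∃¬ dne ¬∀P = dne λ ¬∃ → ¬∀P λ i → dne λ ¬Pi → ¬∃ (i , ¬Pi)

record Bisim (M N : Model n) : Set₁ where
  field
    Z     : W M → W N → Set
    atom  : ∀ {w v} → Z w v → ∀ p → V M p w ⇔ V N p v
    forth : ∀ {w v} → Z w v → ∀ a w' → R M a w w' →
            Σ (W N) λ v' → R N a v v' × Z w' v'
    back  : ∀ {w v} → Z w v → ∀ a v' → R N a v v' →
            Σ (W M) λ w' → R M a w w' × Z w' v'
open Bisim

module _ {M N : Model n} (B : Bisim M N) where

  box-cong : {P : W M → Set} {Q : W N → Set} →
             (∀ {w v} → Z B w v → P w ⇔ Q v) →
             ∀ {w v} → Z B w v → ∀ a →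
             (∀ w' → R M a w w' → P w') ⇔ (∀ v' → R N a v v' → Q v')
  box-cong P⇔Q z a = mk⇔
    (λ p v' r → let (w' , r' , z') = back B z a v' r in to (P⇔Q z') (p w' r'))
    (λ q w' r → let (v' , r' , z') = forth B z a w' r in from (P⇔Q z') (q v' r'))

  satEL-bisim : ∀ {w v} → Z B w v → ∀ χ → satEL M w χ ⇔ satEL N v χ
  satEL-bisim z (var p)   = atom B z p
  satEL-bisim z (¬ₑ χ)    = ¬-cong-⇔ (satEL-bisim z χ)
  satEL-bisim z (χ ∧ₑ χ') = satEL-bisim z χ ×-⇔ satEL-bisim z χ'
  satEL-bisim z (Kₑ a χ)  = box-cong (λ z' → satEL-bisim z' χ) z a

  satG-bisim : ∀ {w v} → Z B w v → ∀ H ψ → satG M w H ψ ⇔ satG N v H ψ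
  satG-bisim z H ψ = ∀-cong λ i → →-cong-⇔ (⇔-id (i ∈ H)) (satEL-bisim z (Kₑ i (ψ i)))

  restrict : {D : W M → Set} {E : W N → Set} →
             (∀ {w v} → Z B w v → D w ⇔ E v) → Bisim (M ↾ D) (N ↾ E)
  Z (restrict D⇔E) (w , _) (v , _) = Z B w v
  atom (restrict D⇔E) z p = atom B z p
  forth (restrict D⇔E) z a (w' , d') r =
    let (v' , r' , z') = forth B z a w' r in (v' , to (D⇔E z') d') , r' , z'
  back (restrict D⇔E) z a (v' , e') r =
    let (w' , r' , z') = back B z a v' r in (w' , from (D⇔E z') e') , r' , z'

sat-bisim : {M N : Model n} (B : Bisim M N) →
            ∀ {w v} → Z B w v → ∀ φ → sat M w φ ⇔ sat N v φ
sat-bisim B z (var p)  = atom B z p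
sat-bisim B z (¬' φ)   = ¬-cong-⇔ (sat-bisim B z φ)
sat-bisim B z (φ ∧' ψ) = sat-bisim B z φ ×-⇔ sat-bisim B z ψ
sat-bisim B z (K a φ)  = box-cong B (λ z' → sat-bisim B z' φ) z a
sat-bisim {M = M} {N} B z ([ φ ] ψ) =
  Π-cong (sat-bisim B z φ) λ _ _ → sat-bisim (restrict B announced) z ψ
  where
  announced : ∀ {w v} → Z B w v → sat M w φ ⇔ sat N v φ
  announced z' = sat-bisim B z' φ
sat-bisim {M = M} {N} B z ([ H ∣ χ ] φ) =
  sat-bisim B z χ ×-⇔
  ∀-cong λ ψ → Π-cong (announced ψ z) λ _ _ →
                 sat-bisim (restrict B (announced ψ)) z φ
  where
  announced : ∀ ψ {w v} → Z B w v →
              (satG M w H ψ × sat M w χ) ⇔ (satG N v H ψ × sat N v χ)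
  announced ψ z' = satG-bisim B z' H ψ ×-⇔ sat-bisim B z' χ
sat-bisim {M = M} {N} B z ([⟨ H ⟩] φ) =
  ∀-cong λ ψ → ∃-cong λ χ →
    →-cong-⇔ (satG-bisim B z H ψ)
      (¬-cong-⇔ (Π-cong (announced ψ χ z) λ _ _ →
                   ¬-cong-⇔ (sat-bisim (restrict B (announced ψ χ)) z φ)))
  where
  announced : ∀ ψ χ {w v} → Z B w v →
              (satG M w H ψ × satG M w (∁ H) χ) ⇔ (satG N v H ψ × satG N v (∁ H) χ)
  announced ψ χ z' = satG-bisim B z' H ψ ×-⇔ satG-bisim B z' (∁ H) χ

⊤ₑ : ELForm n
⊤ₑ = ¬ₑ (var 0 ∧ₑ (¬ₑ var 0))

⊤ₑ-holds : (M : Model n) (v : W M) → satEL M v ⊤ₑ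
⊤ₑ-holds M v (p , ¬p) = ¬p p

⊤'-holds : (M : Model n) (v : W M) → sat M v ⊤'
⊤'-holds M v (p , ¬p) = ¬p p

_⇒ₑ_ : ELForm n → ELForm n → ELForm n
α ⇒ₑ β = ¬ₑ (α ∧ₑ (¬ₑ β))

-- rel Ψ χ says at a state of M what χ says there after Ψ is announced:
-- every K_a is restricted to the Ψ-states.
rel : ELForm n → ELForm n → ELForm n
rel Ψ (var p)   = var p
rel Ψ (¬ₑ χ)    = ¬ₑ (rel Ψ χ)
rel Ψ (χ ∧ₑ χ') = (rel Ψ χ) ∧ₑ (rel Ψ χ')
rel Ψ (Kₑ a χ)  = Kₑ a (Ψ ⇒ₑ rel Ψ χ)

-- Relativisation of a coalition announcement, componentwise; note that
-- K_i (relG Ψ χ i) is literally rel Ψ (K_i (χ i)).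
relG : ELForm n → (Fin n → ELForm n) → Fin n → ELForm n
relG Ψ χ i = Ψ ⇒ₑ rel Ψ (χ i)

module _ (dne : DoubleNegationElimination 0ℓ) (M : Model n)
         {D : W M → Set} (Ψ : ELForm n) (D⇔Ψ : ∀ v → D v ⇔ satEL M v Ψ) where

  relativise : ∀ χ v (d : D v) → satEL (M ↾ D) (v , d) χ ⇔ satEL M v (rel Ψ χ)
  relativise (var p)   v d = ⇔-id (V M p v)
  relativise (¬ₑ χ)    v d = ¬-cong-⇔ (relativise χ v d)
  relativise (χ ∧ₑ χ') v d = relativise χ v d ×-⇔ relativise χ' v d
  relativise (Kₑ a χ)  v d = mk⇔
    (λ known u r (Ψu , ¬χu) →
       let du = from (D⇔Ψ u) Ψu in ¬χu (to (relativise χ u du) (known (u , du) r)))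
    (λ known (u , du) r →
       from (relativise χ u du) (dne λ ¬χu → known u r (to (D⇔Ψ u) du , ¬χu)))

  relativiseG : ∀ H χ v (d : D v) → satG (M ↾ D) (v , d) H χ ⇔ satG M v H (relG Ψ χ)
  relativiseG H χ v d = ∀-cong λ i → →-cong-⇔ (⇔-id (i ∈ H)) (relativise (Kₑ i (χ i)) v d)

⋀ : (k : ℕ) → (Fin k → ELForm n) → ELForm n
⋀ zero    α = ⊤ₑ
⋀ (suc k) α = (α zero) ∧ₑ (⋀ k (λ i → α (suc i)))

⋀-sat : (M : Model n) (v : W M) (k : ℕ) (α : Fin k → ELForm n) →
        satEL M v (⋀ k α) ⇔ (∀ i → satEL M v (α i))
⋀-sat M v zero    α = mk⇔ (λ _ ()) (λ _ → ⊤ₑ-holds M v)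
⋀-sat M v (suc k) α = mk⇔
  (λ { (α₀ , αs) zero → α₀ ; (α₀ , αs) (suc i) → to (⋀-sat M v k _) αs i })
  (λ αs → αs zero , from (⋀-sat M v k _) (λ i → αs (suc i)))

conjunct : Subset n → (Fin n → ELForm n) → Fin n → ELForm n
conjunct H ψ i with i ∈? H
... | yes _ = Kₑ i (ψ i)
... | no  _ = ⊤ₑ

conjunct-sat : (M : Model n) (v : W M) (H : Subset n) (ψ : Fin n → ELForm n) (i : Fin n) →
               satEL M v (conjunct H ψ i) ⇔ (i ∈ H → satEL M v (Kₑ i (ψ i)))
conjunct-sat M v H ψ i with i ∈? H
... | yes i∈H = mk⇔ (λ Kψ _ → Kψ) (λ Kψ → Kψ i∈H)
... | no  i∉H = mk⇔ (λ _ i∈H → ⊥-elim (i∉H i∈H)) (λ _ → ⊤ₑ-holds M v)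

char : Subset n → (Fin n → ELForm n) → ELForm n
char {n} H ψ = ⋀ n (conjunct H ψ)

char-sat : (M : Model n) (v : W M) (H : Subset n) (ψ : Fin n → ELForm n) →
           satEL M v (char H ψ) ⇔ satG M v H ψ
char-sat {n} M v H ψ = ∀-cong (λ i → conjunct-sat M v H ψ i) ⇔-∘ ⋀-sat M v n _

restrict-twice : (M : Model n) (D : W M → Set) (E : W (M ↾ D) → Set) (F : W M → Set) →
                 (∀ v → F v ⇔ Σ (D v) (λ d → E (v , d))) →
                 Bisim ((M ↾ D) ↾ E) (M ↾ F)
Z (restrict-twice M D E F F⇔DE) x y = proj₁ (proj₁ x) ≡ proj₁ y
atom (restrict-twice M D E F F⇔DE) {(w , _) , _} {.w , _} refl p = ⇔-id (V M p w)
forth (restrict-twice M D E F F⇔DE) {(w , _) , _} {.w , _} refl a ((v , d) , e) r =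
  (v , from (F⇔DE v) (d , e)) , r , refl
back (restrict-twice M D E F F⇔DE) {(w , _) , _} {.w , _} refl a (v , f) r =
  let (d , e) = to (F⇔DE v) f in ((v , d) , e) , r , refl

cannot-force⇒can-refute : ExcludedMiddle 0ℓ → (G : Subset n) (φ : Form n) (M : Model n) (w : W M) →
  sat M w ([ G ]ᶜ (¬' ([ ∁ G ]ᶜ φ))) → sat M w ([⟨ G ⟩] (¬' φ))
cannot-force⇒can-refute {n} lem G φ M w (_ , cannot-force) ψ with lem {satG M w G ψ}
... | no ¬ψw = (λ _ → ⊤ₑ) , λ ψw → ⊥-elim (¬ψw ψw)
-- Otherwise A∖G answers χ' = relG Ψ χ; if φ survived ψ_G ∧ χ' in M, it
-- would survive χ in M^{ψ_G}, by the bisimulation B.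
... | yes ψw = relG Ψ χ , λ _ χ'-keeps-φ →
  φ-fails λ e → from (sat-bisim B {(w , d) , e} {w , from (F⇔DE w) (d , e)} refl φ)
                     (dne (χ'-keeps-φ (from (F⇔DE w) (d , e))))
  where
  dne : DoubleNegationElimination 0ℓ
  dne = em⇒dne lem

  -- M^{ψ_G}: the model after G announces ψ_G (conjoined with ⊤, as in [G]).
  D : W M → Set
  D v = satG M v G ψ × sat M v ⊤'

  d : D w
  d = ψw , ⊤'-holds M w

  Ψ : ELForm n
  Ψ = char G ψ

  D⇔Ψ : ∀ v → D v ⇔ satEL M v Ψ
  D⇔Ψ v = mk⇔ (λ (ψv , _) → from (char-sat M v G ψ) ψv)
              (λ Ψv → to (char-sat M v G ψ) Ψv , ⊤'-holds M v)

  E : (Fin n → ELForm n) → W (M ↾ D) → Set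
  E χ x = satG (M ↾ D) x (∁ G) χ × sat (M ↾ D) x ⊤'

  refutation : ∃ λ χ → ¬ ((e : E χ (w , d)) → sat ((M ↾ D) ↾ E χ) ((w , d) , e) φ)
  refutation = ¬∀⇒∃¬ dne λ force → cannot-force ψ d (⊤'-holds (M ↾ D) (w , d) , force)

  χ : Fin n → ELForm n
  χ = proj₁ refutation

  φ-fails : ¬ ((e : E χ (w , d)) → sat ((M ↾ D) ↾ E χ) ((w , d) , e) φ)
  φ-fails = proj₂ refutation

  F : W M → Set
  F v = satG M v G ψ × satG M v (∁ G) (relG Ψ χ)

  F⇔DE : ∀ v → F v ⇔ Σ (D v) (λ dv → E χ (v , dv))
  F⇔DE v = mk⇔
    (λ (ψv , χ'v) → let dv = ψv , ⊤'-holds M v in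
       dv , from (relativiseG dne M Ψ D⇔Ψ (∁ G) χ v dv) χ'v , ⊤'-holds (M ↾ D) (v , dv))
    (λ (dv , χv , _) → proj₁ dv , to (relativiseG dne M Ψ D⇔Ψ (∁ G) χ v dv) χv)

  B : Bisim ((M ↾ D) ↾ E χ) (M ↾ F)
  B = restrict-twice M D (E χ) F F⇔DE

proposition3 : ExcludedMiddle 0ℓ →
    (n : ℕ) (G : Subset n) (φ : Form n) →
      Valid ((⟨[ G ]⟩ φ) ⇒ (⟨ G ⟩ᶜ ([ ∁ G ]ᶜ φ)))
proposition3 lem n G φ M w (not-refutable , not-cannot-force) =
  not-cannot-force λ cannot-force →
    not-refutable (cannot-force⇒can-refute lem G φ M w cannot-force)
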